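{- Let $\tau,\gamma$ be non-negative integers such that, for some positive integer $\lambda$, $\gamma<\lambda$, $3\gamma+4<\tau$, $2\lambda+\gamma<\tau$ and $6\lambda\le\tau$. Let $S_1,S_2,S_3$ be pairwise disjoint vertex sets and $B(S_1,S_2,S_3)$ a bottleneck sequence on them. Then every direct order of $B(S_1,S_2,S_3)$ is $\tau$-balancing.
   Context: A $(\tau,\gamma)$-bottleneck on terminals $v_1,\dots,v_k$ (first terminal $v_1$) is the edge-weighted caterpillar obtained from a path (spine) $a_1b_1\dots a_kb_k$ with $\omega(a_ib_i)=\tau$ and $\omega(b_ia_{i+1})=\gamma+1$, by adding for each $i$ a leaf $v_i$ adjacent to $a_i$ (the attachment of $v_i$) with $\gamma+1\le\omega(v_ia_i)\le\tau-\gamma-1$; it is rooted at $b_k$. A bottleneck sequence $B(S_1,S_2,S_3)$ is obtained by taking three new vertices $s_1,s_2,s_3$ and: for $i\in\{1,2\}$ a bottleneck $B_i^+$ with terminal set $S_i\cup\{s_i\}$, first terminal $s_i$ with attachment weight $\gamma+1$; for $i\in\{2,3\}$ a bottleneck $B_i^-$ with terminal set $S_i\cup\{s_i\}$, first terminal $s_i$ with attachment weight $\gamma+1$ (terminals shared, spines new and otherwise disjoint); for $i\in\{1,2\}$ the roots of $B_i^+$ and $B_{i+1}^-$ are identified; and edges $s_1s_2$, $s_2s_3$ of weight $\lfloor(\tau+\gamma)/2\rfloor+1$. A direct order of a bottleneck with terminals $v_1,\dots,v_k$ and spine $a_1b_1\dots a_kb_k$ is any total order with $\{v_1,\dots,v_k\}\prec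 a_1\prec b_1\prec\dots\prec a_k\prec b_k$ (terminals in any order among themselves); a reverse order is the reverse of a direct order. A direct order of $B(S_1,S_2,S_3)$ is a total order on its vertex set extending direct orders of $B_1^+$ and $B_2^+$ and reverse orders of $B_2^-$ and $B_3^-$. A total order is $\tau$-balancing if every vertex $v$ has $\sum_{u\in N(v),u\prec v}\omega(uv)\le\tau$ and $\sum_{u\in N(v),v\prec u}\omega(uv)\le\tau$. -}

module Defs where

open import Data.Nat using (ℕ; zero; suc; _+_; _*_; _∸_; _≤_; _<_; _>_)
open import Data.Nat.Properties using (_<?_)
open import Data.Nat.DivMod using (_/_)
open import Data.Fin using (Fin; zero; suc; inject₁)
import Data.Fin.Properties as FinP
open import Data.Fin.Permutation using (Permutation′; _⟨$⟩ʳ_)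
open import Data.Bool using (Bool; true; false; _∧_; if_then_else_)
open import Data.List using (List; []; _∷_; _++_; map; concatMap; allFin)
open import Data.Nat.ListAction using (sum)
open import Data.Product using (_×_; _,_)
open import Function using (_∘_)
open import Function.Definitions using (Injective)
open import Relation.Nullary using (Dec; yes; no; does)
open import Relation.Binary.PropositionalEquality using (_≡_; refl)

-- The four bottlenecks B₁⁺, B₂⁺, B₂⁻, B₃⁻ of a bottleneck sequence.

data Bn : Set where
  p1 p2 m2 m3 : Bn

-- index i of the terminal set S_i ∪ {s_i} used by the bottleneck
idx : Bn → Fin 3
idx p1 = zero
idx p2 = suc zero
idx m2 = suc zero
idx m3 = suc (suc zero)

-- which identified root: root(B₁⁺) = root(B₂⁻) is rt 0, root(B₂⁺) = root(B₃⁻) is rt 1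
rootIx : Bn → Fin 2
rootIx p1 = zero
rootIx m2 = zero
rootIx p2 = suc zero
rootIx m3 = suc zero

_≟Bn_ : (x y : Bn) → Dec (x ≡ y)
p1 ≟Bn p1 = yes refl
p1 ≟Bn p2 = no λ ()
p1 ≟Bn m2 = no λ ()
p1 ≟Bn m3 = no λ ()
p2 ≟Bn p1 = no λ ()
p2 ≟Bn p2 = yes refl
p2 ≟Bn m2 = no λ ()
p2 ≟Bn m3 = no λ ()
m2 ≟Bn p1 = no λ ()
m2 ≟Bn p2 = no λ ()
m2 ≟Bn m2 = yes refl
m2 ≟Bn m3 = no λ ()
m3 ≟Bn p1 = no λ ()
m3 ≟Bn p2 = no λ ()
m3 ≟Bn m2 = no λ ()
m3 ≟Bn m3 = yes refl

-- Vertex set of B(S₁,S₂,S₃), where |S_i| = k i and S_i = {tv i j | j : Fin (k i)}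
-- (so the S_i are pairwise disjoint and disjoint from everything else).
-- A bottleneck with k i + 1 terminals has spine a₀ b₀ … a_{k i} b_{k i};
-- av β p is a_p, bv β p is b_p for p < k i, and the root b_{k i} is rt (rootIx β)
-- (this realizes the identification of roots).

data V (k : Fin 3 → ℕ) : Set where
  sv : Fin 3 → V k
  tv : (i : Fin 3) → Fin (k i) → V k
  av : (β : Bn) → Fin (suc (k (idx β))) → V k
  bv : (β : Bn) → Fin (k (idx β)) → V k
  rt : Fin 2 → V k

module _ {k : Fin 3 → ℕ} where
  _≟V_ : (x y : V k) → Dec (x ≡ y)
  sv i ≟V sv j with i FinP.≟ j
  ... | yes refl = yes refl
  ... | no ne = no λ { refl → ne refl }
  sv _ ≟V tv _ _ = no λ ()
  sv _ ≟V av _ _ = no λ ()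
  sv _ ≟V bv _ _ = no λ ()
  sv _ ≟V rt _ = no λ ()
  tv _ _ ≟V sv _ = no λ ()
  tv i j ≟V tv i' j' with i FinP.≟ i'
  ... | no ne = no λ { refl → ne refl }
  ... | yes refl with j FinP.≟ j'
  ...   | yes refl = yes refl
  ...   | no ne = no λ { refl → ne refl }
  tv _ _ ≟V av _ _ = no λ ()
  tv _ _ ≟V bv _ _ = no λ ()
  tv _ _ ≟V rt _ = no λ ()
  av _ _ ≟V sv _ = no λ ()
  av _ _ ≟V tv _ _ = no λ ()
  av β p ≟V av β' p' with β ≟Bn β'
  ... | no ne = no λ { refl → ne refl }
  ... | yes refl with p FinP.≟ p'
  ...   | yes refl = yes refl
  ...   | no ne = no λ { refl → ne refl }
  av _ _ ≟V bv _ _ = no λ ()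
  av _ _ ≟V rt _ = no λ ()
  bv _ _ ≟V sv _ = no λ ()
  bv _ _ ≟V tv _ _ = no λ ()
  bv _ _ ≟V av _ _ = no λ ()
  bv β p ≟V bv β' p' with β ≟Bn β'
  ... | no ne = no λ { refl → ne refl }
  ... | yes refl with p FinP.≟ p'
  ...   | yes refl = yes refl
  ...   | no ne = no λ { refl → ne refl }
  bv _ _ ≟V rt _ = no λ ()
  rt _ ≟V sv _ = no λ ()
  rt _ ≟V tv _ _ = no λ ()
  rt _ ≟V av _ _ = no λ ()
  rt _ ≟V bv _ _ = no λ ()
  rt i ≟V rt j with i FinP.≟ j
  ... | yes refl = yes refl
  ... | no ne = no λ { refl → ne refl }

lastOr : ∀ {n} {A : Set} → A → (Fin n → A) → Fin (suc n) → A
lastOr {zero} r f zero = r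
lastOr {suc n} r f zero = f zero
lastOr {suc n} r f (suc p) = lastOr r (f ∘ suc) p

-- Data of a bottleneck sequence B(S₁,S₂,S₃) for parameters τ γ:
--  * k i = |S_i|;
--  * perm β : the order in which the terminals of S_i appear (after the
--    first terminal s_i) along bottleneck β;
--  * att β j : weight of the attachment edge of the (j+2)-nd terminal of β,
--    with γ+1 ≤ att β j ≤ τ-γ-1 (the first terminal s_i has weight γ+1).

record BSeq (τ γ : ℕ) : Set where
  field
    k     : Fin 3 → ℕ
    perm  : (β : Bn) → Permutation′ (k (idx β))
    att   : (β : Bn) → Fin (k (idx β)) → ℕ
    att-lo : ∀ β j → suc γ ≤ att β j
    att-hi : ∀ β j → att β j ≤ τ ∸ γ ∸ 1

  Vert : Set
  Vert = V k

  bAt : (β : Bn) → Fin (suc (k (idx β))) → Vert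
  bAt β = lastOr (rt (rootIx β)) (bv β)

  termAt : (β : Bn) → Fin (suc (k (idx β))) → Vert
  termAt β zero = sv (idx β)
  termAt β (suc j) = tv (idx β) (perm β ⟨$⟩ʳ j)

  attW : (β : Bn) → Fin (suc (k (idx β))) → ℕ
  attW β zero = suc γ
  attW β (suc j) = att β j

  Edge : Set
  Edge = Vert × Vert × ℕ

  bnEdges : Bn → List Edge
  bnEdges β =
       map (λ p → av β p , bAt β p , τ) (allFin (suc (k (idx β))))
    ++ map (λ p → bAt β (inject₁ p) , av β (suc p) , suc γ) (allFin (k (idx β)))
    ++ map (λ p → termAt β p , av β p , attW β p) (allFin (suc (k (idx β))))

  mid : ℕ
  mid = suc ((τ + γ) / 2)

  edges : List Edge
  edges = concatMap bnEdges (p1 ∷ p2 ∷ m2 ∷ m3 ∷ [])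
       ++ (sv zero , sv (suc zero) , mid)
        ∷ (sv (suc zero) , sv (suc (suc zero)) , mid) ∷ []

  -- Total orders on the vertex set are given by an injective rank
  -- ρ : Vert → ℕ, with u ≺ v iff ρ u < ρ v.

  -- ordered R ρ β : the restriction of the order to β satisfies
  -- terminals R a₀ R b₀ R a₁ R … R b_last  (R = _<_ : direct; R = _>_ : reverse)
  orderedB : (ℕ → ℕ → Set) → (Vert → ℕ) → Bn → Set
  orderedB R ρ β =
      (∀ p → R (ρ (termAt β p)) (ρ (av β zero)))
    × (∀ p → R (ρ (av β p)) (ρ (bAt β p)))
    × (∀ p → R (ρ (bAt β (inject₁ p))) (ρ (av β (suc p))))

  DirectOrder : (Vert → ℕ) → Set
  DirectOrder ρ =
      Injective _≡_ _≡_ ρ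
    × orderedB _<_ ρ p1 × orderedB _<_ ρ p2
    × orderedB _>_ ρ m2 × orderedB _>_ ρ m3

  backLoad : (Vert → ℕ) → Vert → ℕ
  backLoad ρ v = sum (map contrib edges)
    where
    contrib : Edge → ℕ
    contrib (x , y , w) =
        (if does (x ≟V v) ∧ does (ρ y <? ρ v) then w else 0)
      + (if does (y ≟V v) ∧ does (ρ x <? ρ v) then w else 0)

  fwdLoad : (Vert → ℕ) → Vert → ℕ
  fwdLoad ρ v = sum (map contrib edges)
    where
    contrib : Edge → ℕ
    contrib (x , y , w) =
        (if does (x ≟V v) ∧ does (ρ v <? ρ y) then w else 0)
      + (if does (y ≟V v) ∧ does (ρ v <? ρ x) then w else 0)

  Balancing : (Vert → ℕ) → Set
  Balancing ρ = ∀ v → backLoad ρ v ≤ τ × fwdLoad ρ v ≤ τ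

{-# OPTIONS --safe #-}
-- Every vertex lies on at most two of the four bottlenecks, plus possibly the
-- edges s₁s₂ and s₂s₃.  Inside one bottleneck, ordered directly or reversely,
-- a spine vertex has its heavy edge (weight τ) on one side and its light edges
-- (γ+1 and an attachment of weight ≤ τ-γ-1) on the other, so each side weighs
-- at most τ.  A vertex shared by two bottlenecks (a root, s₂, a terminal of S₂)
-- lies on one direct and one reversed bottleneck, so its two matching edges fall
-- on opposite sides; likewise s₁ ≺ s₂ ≺ s₃ separates the two middle edges at s₂.
-- What remains is (γ+1) + (⌊(τ+γ)/2⌋+1) ≤ τ at s₁, s₂, s₃: this is where
-- 3γ+4 < τ is used.
-- Reversing the order swaps back and forward loads as well as direct and
-- reversed bottlenecks, so both loads are bounded by one argument over an
-- arbitrary strict order C in which neighbours are counted.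
module Submission where

open import Defs
open import Data.Nat using (ℕ; zero; suc; _+_; _*_; _∸_; _≤_; _<_; _>_; z≤n)
open import Data.Nat.Properties
open import Data.Nat.DivMod using (_/_; m/n*n≤m)
open import Data.Nat.ListAction using (sum)
open import Data.Nat.ListAction.Properties using (sum-++)
open import Data.Nat.Tactic.RingSolver using (solve-∀)
open import Data.Bool using (Bool; true; false; not; _∧_; if_then_else_)
open import Data.Fin using (Fin; zero; suc; inject₁; fromℕ)
import Data.Fin.Properties as Fin
open import Data.Fin.Permutation using (_⟨$⟩ʳ_; _⟨$⟩ˡ_; inverseˡ; inverseʳ)
open import Data.List using (List; []; _∷_; _++_; map; concatMap; tabulate; allFin)
open import Data.List.Properties using (map-++; map-tabulate)
open import Data.Product using (_×_; _,_; proj₁; proj₂)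
open import Data.Empty using (⊥-elim)
open import Function using (_∘_; id; flip)
open import Level using (0ℓ)
open import Relation.Binary using (Rel; Transitive; Asymmetric; Decidable)
open import Relation.Binary.PropositionalEquality
  using (_≡_; _≢_; refl; sym; trans; cong; cong₂; subst; module ≡-Reasoning)
open import Relation.Nullary using (¬_; does)
open import Relation.Nullary.Decidable using (dec-true; dec-false)

sum-map-++ : ∀ {A : Set} (f : A → ℕ) xs ys →
             sum (map f (xs ++ ys)) ≡ sum (map f xs) + sum (map f ys)
sum-map-++ f xs ys = trans (cong sum (map-++ f xs ys)) (sum-++ (map f xs) (map f ys))

sum-map-concatMap : ∀ {A E : Set} (f : E → ℕ) (g : A → List E) xs →
                    sum (map f (concatMap g xs)) ≡ sum (map (sum ∘ map f ∘ g) xs)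
sum-map-concatMap f g []       = refl
sum-map-concatMap f g (x ∷ xs) =
  trans (sum-map-++ f (g x) (concatMap g xs)) (cong (sum (map f (g x)) +_) (sum-map-concatMap f g xs))

sum-map-allFin : ∀ {A : Set} {n} (g : Fin n → A) (f : A → ℕ) →
                 sum (map f (map g (allFin n))) ≡ sum (tabulate (f ∘ g))
sum-map-allFin g f = cong sum (trans (cong (map f) (map-tabulate id g)) (map-tabulate g f))

sum-tabulate-≡0 : ∀ {n} (f : Fin n → ℕ) → (∀ i → f i ≡ 0) → sum (tabulate f) ≡ 0
sum-tabulate-≡0 {zero}  f f≡0 = refl
sum-tabulate-≡0 {suc n} f f≡0 rewrite f≡0 zero = sum-tabulate-≡0 (f ∘ suc) (f≡0 ∘ suc)

sum-tabulate-single : ∀ {n} (f : Fin n → ℕ) i → (∀ j → j ≢ i → f j ≡ 0) →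
                      sum (tabulate f) ≡ f i
sum-tabulate-single f zero f≡0
  rewrite sum-tabulate-≡0 (f ∘ suc) (λ j → f≡0 (suc j) λ ()) = +-identityʳ (f zero)
sum-tabulate-single f (suc i) f≡0 rewrite f≡0 zero (λ ()) =
  sum-tabulate-single (f ∘ suc) i (λ j j≢i → f≡0 (suc j) (j≢i ∘ Fin.suc-injective))

[_]·_ : Bool → ℕ → ℕ
[ b ]· w = if b then w else 0

[]·-≤ : ∀ b w → [ b ]· w ≤ w
[]·-≤ true  w = ≤-refl
[]·-≤ false w = z≤n

[]·+0-≤ : ∀ b w → [ b ]· w + 0 ≤ w
[]·+0-≤ b w = ≤-trans (≤-reflexive (+-identityʳ _)) ([]·-≤ b w)

[]·+[not]·≡ : ∀ s w → [ s ]· w + ([ not s ]· w + 0) ≡ w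
[]·+[not]·≡ true  w = +-identityʳ w
[]·+[not]·≡ false w = +-identityʳ w

data LastOr {A : Set} {n} (r : A) (f : Fin n → A) : Fin (suc n) → A → Set where
  inner : ∀ j → LastOr r f (inject₁ j) (f j)
  last  : LastOr r f (fromℕ n) r

lastOr-view : ∀ {A : Set} {n} (r : A) (f : Fin n → A) q → LastOr r f q (lastOr r f q)
lastOr-view {n = zero}  r f zero = last
lastOr-view {n = suc n} r f zero = inner zero
lastOr-view {n = suc n} r f (suc q) with lastOr r (f ∘ suc) q | lastOr-view r (f ∘ suc) q
... | _ | inner j = inner (suc j)
... | _ | last    = last

lastOr-inject₁ : ∀ {A : Set} {n} (r : A) (f : Fin n → A) j → lastOr r f (inject₁ j) ≡ f j
lastOr-inject₁ {n = suc n} r f zero    = refl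
lastOr-inject₁ {n = suc n} r f (suc j) = lastOr-inject₁ r (f ∘ suc) j

lastOr-fromℕ : ∀ {A : Set} {n} (r : A) (f : Fin n → A) → lastOr r f (fromℕ n) ≡ r
lastOr-fromℕ {n = zero}  r f = refl
lastOr-fromℕ {n = suc n} r f = lastOr-fromℕ r (f ∘ suc)

alternating-chain : ∀ {A : Set} {R : Rel A 0ℓ} {n x} → Transitive R → (a b : Fin (suc n) → A) →
                    R x (a zero) → (∀ p → R (a p) (b p)) → (∀ p → R (b (inject₁ p)) (a (suc p))) →
                    ∀ p → R x (a p)
alternating-chain R-trans a b x≺a₀ a≺b b≺a zero = x≺a₀
alternating-chain {n = suc n} {x} R-trans a b x≺a₀ a≺b b≺a (suc p) =
  alternating-chain {x = x} R-trans (a ∘ suc) (b ∘ suc) (R-trans (R-trans x≺a₀ (a≺b zero)) (b≺a zero))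
                    (a≺b ∘ suc) (b≺a ∘ suc) p

module Arithmetic (τ γ : ℕ) (3γ+4<τ : 3 * γ + 4 < τ) where

  2+2γ≤τ : suc γ + suc γ ≤ τ
  2+2γ≤τ = ≤-trans (subst (suc γ + suc γ ≤_) (identity γ) (m≤m+n _ (γ + 2))) (<⇒≤ 3γ+4<τ)
    where
    identity : ∀ g → suc g + suc g + (g + 2) ≡ 3 * g + 4
    identity = solve-∀

  1+γ≤τ : suc γ ≤ τ
  1+γ≤τ = ≤-trans (m≤n+m (suc γ) (suc γ)) 2+2γ≤τ

  τ∸γ∸1≡τ∸[1+γ] : τ ∸ γ ∸ 1 ≡ τ ∸ suc γ
  τ∸γ∸1≡τ∸[1+γ] = trans (∸-+-assoc τ γ 1) (cong (τ ∸_) (+-comm γ 1))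

  τ∸γ∸1≤τ : τ ∸ γ ∸ 1 ≤ τ
  τ∸γ∸1≤τ = ≤-trans (m∸n≤m (τ ∸ γ) 1) (m∸n≤m τ γ)

  1+γ≤τ∸γ∸1 : suc γ ≤ τ ∸ γ ∸ 1
  1+γ≤τ∸γ∸1 rewrite τ∸γ∸1≡τ∸[1+γ] = m+n≤o⇒m≤o∸n (suc γ) 2+2γ≤τ

  1+γ+[τ∸γ∸1]≤τ : suc γ + (τ ∸ γ ∸ 1) ≤ τ
  1+γ+[τ∸γ∸1]≤τ rewrite τ∸γ∸1≡τ∸[1+γ] | m+[n∸m]≡n 1+γ≤τ = ≤-refl

  1+γ+mid≤τ : suc γ + suc ((τ + γ) / 2) ≤ τ
  1+γ+mid≤τ = *-cancelˡ-≤ 2 (begin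
      2 * (suc γ + suc h)    ≡⟨ e₁ γ h ⟩
      (4 + 2 * γ) + h * 2    ≤⟨ +-monoʳ-≤ (4 + 2 * γ) (m/n*n≤m (τ + γ) 2) ⟩
      (4 + 2 * γ) + (τ + γ)  ≡⟨ e₂ γ τ ⟩
      (3 * γ + 4) + τ        ≤⟨ +-monoˡ-≤ τ (<⇒≤ 3γ+4<τ) ⟩
      τ + τ                  ≡⟨ e₃ τ ⟩
      2 * τ                  ∎)
    where
    open ≤-Reasoning
    h = (τ + γ) / 2
    e₁ : ∀ g x → 2 * (suc g + suc x) ≡ (4 + 2 * g) + x * 2
    e₁ = solve-∀
    e₂ : ∀ g t → (4 + 2 * g) + (t + g) ≡ (3 * g + 4) + t
    e₂ = solve-∀
    e₃ : ∀ t → t + t ≡ 2 * t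
    e₃ = solve-∀

orient : Bool → Rel ℕ 0ℓ → Rel ℕ 0ℓ
orient true  C = C
orient false C = flip C

polarity : Bool → Bn → Bool
polarity b p1 = b
polarity b p2 = b
polarity b m2 = not b
polarity b m3 = not b

module Bottlenecks {τ γ : ℕ} (B : BSeq τ γ) where
  open BSeq B

  s₁ s₂ s₃ : Vert
  s₁ = sv zero
  s₂ = sv (suc zero)
  s₃ = sv (suc (suc zero))

  spineEdge : ∀ β → Fin (suc (k (idx β))) → Edge
  spineEdge β p = av β p , bAt β p , τ

  linkEdge : ∀ β → Fin (k (idx β)) → Edge
  linkEdge β p = bAt β (inject₁ p) , av β (suc p) , suc γ

  attachEdge : ∀ β → Fin (suc (k (idx β))) → Edge
  attachEdge β p = termAt β p , av β p , attW β p

  midEdges : List Edge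
  midEdges = (s₁ , s₂ , mid) ∷ (s₂ , s₃ , mid) ∷ []

  -- P u says whether the neighbour u of v is counted; opacity lets unification
  -- recover v and P from a goal.
  opaque
    weightAt : Vert → (Vert → Bool) → Edge → ℕ
    weightAt v P (x , y , w) = [ does (x ≟V v) ∧ P y ]· w + [ does (y ≟V v) ∧ P x ]· w

  opaque
    unfolding weightAt

    weightAt-≢ : ∀ {v P x y w} → x ≢ v → y ≢ v → weightAt v P (x , y , w) ≡ 0
    weightAt-≢ {v} {x = x} {y} x≢v y≢v
      rewrite dec-false (x ≟V v) x≢v | dec-false (y ≟V v) y≢v = refl

    weightAt-source : ∀ {v P x y w} → x ≡ v → y ≢ v → weightAt v P (x , y , w) ≡ [ P y ]· w
    weightAt-source {v} {y = y} refl y≢v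
      rewrite dec-true (v ≟V v) refl | dec-false (y ≟V v) y≢v = +-identityʳ _

    weightAt-target : ∀ {v P x y w} → x ≢ v → y ≡ v → weightAt v P (x , y , w) ≡ [ P x ]· w
    weightAt-target {v} {x = x} x≢v refl
      rewrite dec-false (x ≟V v) x≢v | dec-true (v ≟V v) refl = refl

  load : Vert → (Vert → Bool) → ℕ
  load v P = sum (map (weightAt v P) edges)

  opaque
    unfolding weightAt

    backLoad≡load : ∀ ρ v → backLoad ρ v ≡ load v (λ u → does (ρ u <? ρ v))
    backLoad≡load ρ v = refl

    fwdLoad≡load : ∀ ρ v → fwdLoad ρ v ≡ load v (λ u → does (ρ v <? ρ u))
    fwdLoad≡load ρ v = refl

  bnLoad : (Vert → Bool) → Vert → Bn → ℕ
  bnLoad P v β = sum (map (weightAt v P) (bnEdges β))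

  midLoad : (Vert → Bool) → Vert → ℕ
  midLoad P v = sum (map (weightAt v P) midEdges)

  familyLoad : Vert → (Vert → Bool) → ∀ {n} → (Fin n → Edge) → ℕ
  familyLoad v P e = sum (tabulate (weightAt v P ∘ e))

  familyLoad-≡0 : ∀ {v P n} (e : Fin n → Edge) → (∀ j → weightAt v P (e j) ≡ 0) →
                  familyLoad v P e ≡ 0
  familyLoad-≡0 {v} {P} e = sum-tabulate-≡0 (weightAt v P ∘ e)

  familyLoad-single : ∀ {v P n} (e : Fin n → Edge) i → (∀ j → j ≢ i → weightAt v P (e j) ≡ 0) →
                      familyLoad v P e ≡ weightAt v P (e i)
  familyLoad-single {v} {P} e = sum-tabulate-single (weightAt v P ∘ e)

  load-split : ∀ v P → load v P ≡
    (bnLoad P v p1 + (bnLoad P v p2 + (bnLoad P v m2 + (bnLoad P v m3 + 0)))) + midLoad P v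
  load-split v P = trans (sum-map-++ (weightAt v P) (concatMap bnEdges bottlenecks) midEdges)
    (cong (_+ midLoad P v) (sum-map-concatMap (weightAt v P) bnEdges bottlenecks))
    where bottlenecks = p1 ∷ p2 ∷ m2 ∷ m3 ∷ []

  bnLoad-split : ∀ P v β → bnLoad P v β ≡
    familyLoad v P (spineEdge β) + (familyLoad v P (linkEdge β) + familyLoad v P (attachEdge β))
  bnLoad-split P v β = begin
    sum (map w (S ++ (L ++ T)))                      ≡⟨ sum-map-++ w S (L ++ T) ⟩
    sum (map w S) + sum (map w (L ++ T))             ≡⟨ cong (sum (map w S) +_) (sum-map-++ w L T) ⟩
    sum (map w S) + (sum (map w L) + sum (map w T))
      ≡⟨ cong₂ _+_ (sum-map-allFin (spineEdge β) w)
                   (cong₂ _+_ (sum-map-allFin (linkEdge β) w) (sum-map-allFin (attachEdge β) w)) ⟩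
    familyLoad v P (spineEdge β) + (familyLoad v P (linkEdge β) + familyLoad v P (attachEdge β)) ∎
    where
    open ≡-Reasoning
    w = weightAt v P
    S = map (spineEdge β) (allFin _)
    L = map (linkEdge β) (allFin _)
    T = map (attachEdge β) (allFin _)

  load-≤-bounds : ∀ P v {a b c d e} →
    bnLoad P v p1 ≤ a → bnLoad P v p2 ≤ b → bnLoad P v m2 ≤ c → bnLoad P v m3 ≤ d →
    midLoad P v ≤ e →
    load v P ≤ (a + (b + (c + (d + 0)))) + e
  load-≤-bounds P v ≤a ≤b ≤c ≤d ≤e rewrite load-split v P =
    +-mono-≤ (+-mono-≤ ≤a (+-mono-≤ ≤b (+-mono-≤ ≤c (+-mono-≤ ≤d ≤-refl)))) ≤e

  data IsB (β : Bn) : Vert → Set where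
    inner : ∀ j → IsB β (bv β j)
    root  : IsB β (rt (rootIx β))

  data IsTerminal (β : Bn) : Vert → Set where
    first : IsTerminal β (sv (idx β))
    other : ∀ j → IsTerminal β (tv (idx β) j)

  bAt-view : ∀ β q → LastOr (rt (rootIx β)) (bv β) q (bAt β q)
  bAt-view β = lastOr-view (rt (rootIx β)) (bv β)

  bAt-inject₁ : ∀ β j → bAt β (inject₁ j) ≡ bv β j
  bAt-inject₁ β = lastOr-inject₁ (rt (rootIx β)) (bv β)

  bAt-fromℕ : ∀ β → bAt β (fromℕ (k (idx β))) ≡ rt (rootIx β)
  bAt-fromℕ β = lastOr-fromℕ (rt (rootIx β)) (bv β)

  bAt-IsB : ∀ β q → IsB β (bAt β q)
  bAt-IsB β q with bAt β q | bAt-view β q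
  ... | _ | inner j = inner j
  ... | _ | last    = root

  bAt≡bv : ∀ {β q j} → bAt β q ≡ bv β j → q ≡ inject₁ j
  bAt≡bv {β} {q} eq with bAt β q | bAt-view β q | eq
  ... | _ | inner j | refl = refl

  bAt≡rt : ∀ {β q r} → bAt β q ≡ rt r → q ≡ fromℕ (k (idx β))
  bAt≡rt {β} {q} eq with bAt β q | bAt-view β q | eq
  ... | _ | last | _ = refl

  termAt-IsTerminal : ∀ β q → IsTerminal β (termAt β q)
  termAt-IsTerminal β zero    = first
  termAt-IsTerminal β (suc j) = other (perm β ⟨$⟩ʳ j)

  bAt≢ : ∀ β q {v} → ¬ IsB β v → bAt β q ≢ v
  bAt≢ β q ¬isB eq = ¬isB (subst (IsB β) eq (bAt-IsB β q))

  termAt≢ : ∀ β q {v} → ¬ IsTerminal β v → termAt β q ≢ v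
  termAt≢ β q ¬isT eq = ¬isT (subst (IsTerminal β) eq (termAt-IsTerminal β q))

  _∉_ : Vert → Bn → Set
  v ∉ β = (∀ p → av β p ≢ v) × ¬ IsB β v × ¬ IsTerminal β v

  ∉-av : ∀ {β β' p} → β ≢ β' → av β' p ∉ β
  ∉-av β≢β' = (λ { _ refl → β≢β' refl }) , (λ ()) , (λ ())

  ∉-bv : ∀ {β β' j} → β ≢ β' → bv β' j ∉ β
  ∉-bv β≢β' = (λ _ ()) , (λ { (inner _) → β≢β' refl }) , (λ ())

  ∉-rt : ∀ {β r} → rootIx β ≢ r → rt r ∉ β
  ∉-rt r≢ = (λ _ ()) , (λ { root → r≢ refl }) , (λ ())

  ∉-sv : ∀ {β i} → idx β ≢ i → sv i ∉ β
  ∉-sv i≢ = (λ _ ()) , (λ ()) , (λ { first → i≢ refl })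

  ∉-tv : ∀ {β i j} → idx β ≢ i → tv i j ∉ β
  ∉-tv i≢ = (λ _ ()) , (λ ()) , (λ { (other _) → i≢ refl })

  bnLoad-∉ : ∀ P {v β} → v ∉ β → bnLoad P v β ≡ 0
  bnLoad-∉ P {v} {β} (¬a , ¬b , ¬t) = trans (bnLoad-split P v β) (cong₂ _+_
    (familyLoad-≡0 (spineEdge β) λ q → weightAt-≢ (¬a q) (bAt≢ β q ¬b))
    (cong₂ _+_
      (familyLoad-≡0 (linkEdge β) λ q → weightAt-≢ (bAt≢ β (inject₁ q) ¬b) (¬a (suc q)))
      (familyLoad-≡0 (attachEdge β) λ q → weightAt-≢ (termAt≢ β q ¬t) (¬a q))))

  vanishes : ∀ P {v β} → v ∉ β → bnLoad P v β ≤ 0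
  vanishes P v∉β = ≤-reflexive (bnLoad-∉ P v∉β)

  midLoad-vanishes : ∀ P {v} → (∀ i → sv i ≢ v) → midLoad P v ≤ 0
  midLoad-vanishes P sv≢v =
    ≤-reflexive (cong₂ _+_ (weightAt-≢ (sv≢v _) (sv≢v _))
                           (cong (_+ 0) (weightAt-≢ (sv≢v _) (sv≢v _))))

  midLoad-s₁ : ∀ P → midLoad P s₁ ≡ [ P s₂ ]· mid + 0
  midLoad-s₁ P = cong₂ _+_ (weightAt-source refl λ ()) (cong (_+ 0) (weightAt-≢ (λ ()) (λ ())))

  midLoad-s₂ : ∀ P → midLoad P s₂ ≡ [ P s₁ ]· mid + ([ P s₃ ]· mid + 0)
  midLoad-s₂ P = cong₂ _+_ (weightAt-target (λ ()) refl) (cong (_+ 0) (weightAt-source refl λ ()))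

  midLoad-s₃ : ∀ P → midLoad P s₃ ≡ [ P s₂ ]· mid + 0
  midLoad-s₃ P = cong₂ _+_ (weightAt-≢ (λ ()) (λ ())) (cong (_+ 0) (weightAt-target (λ ()) refl))

  load-single-≤ : ∀ P v β {w} → (∀ β' → β' ≢ β → v ∉ β') → (∀ i → sv i ≢ v) →
                  bnLoad P v β ≤ w → load v P ≤ w
  load-single-≤ P v β {w} v∉ sv≢v ≤w =
    ≤-trans (bounded β v∉ ≤w) (≤-reflexive (trans (+-identityʳ _) (+-identityʳ w)))
    where
    noMid = midLoad-vanishes P sv≢v
    bounded : ∀ β → (∀ β' → β' ≢ β → v ∉ β') → bnLoad P v β ≤ w → load v P ≤ (w + 0) + 0
    bounded p1 v∉ ≤w = load-≤-bounds P v ≤w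
      (vanishes P (v∉ p2 λ ())) (vanishes P (v∉ m2 λ ())) (vanishes P (v∉ m3 λ ())) noMid
    bounded p2 v∉ ≤w = load-≤-bounds P v (vanishes P (v∉ p1 λ ())) ≤w
      (vanishes P (v∉ m2 λ ())) (vanishes P (v∉ m3 λ ())) noMid
    bounded m2 v∉ ≤w = load-≤-bounds P v (vanishes P (v∉ p1 λ ())) (vanishes P (v∉ p2 λ ()))
      ≤w (vanishes P (v∉ m3 λ ())) noMid
    bounded m3 v∉ ≤w = load-≤-bounds P v (vanishes P (v∉ p1 λ ())) (vanishes P (v∉ p2 λ ()))
      (vanishes P (v∉ m2 λ ())) ≤w noMid

  fromPrevious : (Vert → Bool) → ∀ β → Fin (suc (k (idx β))) → ℕ
  fromPrevious P β zero    = 0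
  fromPrevious P β (suc p) = [ P (bAt β (inject₁ p)) ]· suc γ

  bnLoad-av : ∀ P β p → bnLoad P (av β p) β ≡
    [ P (bAt β p) ]· τ + (fromPrevious P β p + [ P (termAt β p) ]· attW β p)
  bnLoad-av P β p = trans (bnLoad-split P (av β p) β) (cong₂ _+_ spine (cong₂ _+_ (link p) attach))
    where
    spine : familyLoad (av β p) P (spineEdge β) ≡ [ P (bAt β p) ]· τ
    spine = trans
      (familyLoad-single (spineEdge β) p λ q q≢p →
        weightAt-≢ (λ { refl → q≢p refl }) (bAt≢ β q λ ()))
      (weightAt-source refl (bAt≢ β p λ ()))
    link : ∀ p → familyLoad (av β p) P (linkEdge β) ≡ fromPrevious P β p
    link zero    = familyLoad-≡0 (linkEdge β) λ q → weightAt-≢ (bAt≢ β (inject₁ q) λ ()) λ ()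
    link (suc p) = trans
      (familyLoad-single (linkEdge β) p λ q q≢p →
        weightAt-≢ (bAt≢ β (inject₁ q) λ ()) (λ { refl → q≢p refl }))
      (weightAt-target (bAt≢ β (inject₁ p) λ ()) refl)
    attach : familyLoad (av β p) P (attachEdge β) ≡ [ P (termAt β p) ]· attW β p
    attach = trans
      (familyLoad-single (attachEdge β) p λ q q≢p →
        weightAt-≢ (termAt≢ β q λ ()) (λ { refl → q≢p refl }))
      (weightAt-target (termAt≢ β p λ ()) refl)

  bnLoad-bv : ∀ P β j → bnLoad P (bv β j) β ≡
    [ P (av β (inject₁ j)) ]· τ + ([ P (av β (suc j)) ]· suc γ + 0)
  bnLoad-bv P β j = trans (bnLoad-split P (bv β j) β) (cong₂ _+_ spine (cong₂ _+_ link attach))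
    where
    spine : familyLoad (bv β j) P (spineEdge β) ≡ [ P (av β (inject₁ j)) ]· τ
    spine = trans
      (familyLoad-single (spineEdge β) (inject₁ j) λ q q≢j → weightAt-≢ (λ ()) (q≢j ∘ bAt≡bv))
      (weightAt-target (λ ()) (bAt-inject₁ β j))
    link : familyLoad (bv β j) P (linkEdge β) ≡ [ P (av β (suc j)) ]· suc γ
    link = trans
      (familyLoad-single (linkEdge β) j λ q q≢j →
        weightAt-≢ (q≢j ∘ Fin.inject₁-injective ∘ bAt≡bv) (λ ()))
      (weightAt-source (bAt-inject₁ β j) (λ ()))
    attach : familyLoad (bv β j) P (attachEdge β) ≡ 0
    attach = familyLoad-≡0 (attachEdge β) λ q → weightAt-≢ (termAt≢ β q λ ()) (λ ())

  bnLoad-rt : ∀ P β → bnLoad P (rt (rootIx β)) β ≡ [ P (av β (fromℕ (k (idx β)))) ]· τ + 0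
  bnLoad-rt P β = trans (bnLoad-split P (rt (rootIx β)) β) (cong₂ _+_ spine (cong₂ _+_ link attach))
    where
    spine : familyLoad (rt (rootIx β)) P (spineEdge β) ≡ [ P (av β (fromℕ (k (idx β)))) ]· τ
    spine = trans
      (familyLoad-single (spineEdge β) (fromℕ _) λ q q≢last → weightAt-≢ (λ ()) (q≢last ∘ bAt≡rt))
      (weightAt-target (λ ()) (bAt-fromℕ β))
    link : familyLoad (rt (rootIx β)) P (linkEdge β) ≡ 0
    link = familyLoad-≡0 (linkEdge β) λ q →
      weightAt-≢ (Fin.fromℕ≢inject₁ ∘ sym ∘ bAt≡rt) (λ ())
    attach : familyLoad (rt (rootIx β)) P (attachEdge β) ≡ 0
    attach = familyLoad-≡0 (attachEdge β) λ q → weightAt-≢ (termAt≢ β q λ ()) (λ ())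

  bnLoad-sv : ∀ P β → bnLoad P (sv (idx β)) β ≡ [ P (av β zero) ]· suc γ
  bnLoad-sv P β = trans (bnLoad-split P (sv (idx β)) β) (cong₂ _+_ spine (cong₂ _+_ link attach))
    where
    spine : familyLoad (sv (idx β)) P (spineEdge β) ≡ 0
    spine = familyLoad-≡0 (spineEdge β) λ q → weightAt-≢ (λ ()) (bAt≢ β q λ ())
    link : familyLoad (sv (idx β)) P (linkEdge β) ≡ 0
    link = familyLoad-≡0 (linkEdge β) λ q → weightAt-≢ (bAt≢ β (inject₁ q) λ ()) (λ ())
    attach : familyLoad (sv (idx β)) P (attachEdge β) ≡ [ P (av β zero) ]· suc γ
    attach = trans
      (familyLoad-single (attachEdge β) zero λ
        { zero    0≢0 → ⊥-elim (0≢0 refl)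
        ; (suc q) _   → weightAt-≢ (λ ()) (λ ()) })
      (weightAt-source refl (λ ()))

  bnLoad-tv : ∀ P β j → bnLoad P (tv (idx β) j) β ≡
    [ P (av β (suc (perm β ⟨$⟩ˡ j))) ]· att β (perm β ⟨$⟩ˡ j)
  bnLoad-tv P β j = trans (bnLoad-split P (tv (idx β) j) β) (cong₂ _+_ spine (cong₂ _+_ link attach))
    where
    i = perm β ⟨$⟩ˡ j
    spine : familyLoad (tv (idx β) j) P (spineEdge β) ≡ 0
    spine = familyLoad-≡0 (spineEdge β) λ q → weightAt-≢ (λ ()) (bAt≢ β q λ ())
    link : familyLoad (tv (idx β) j) P (linkEdge β) ≡ 0
    link = familyLoad-≡0 (linkEdge β) λ q → weightAt-≢ (bAt≢ β (inject₁ q) λ ()) (λ ())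
    attach : familyLoad (tv (idx β) j) P (attachEdge β) ≡ [ P (av β (suc i)) ]· att β i
    attach = trans
      (familyLoad-single (attachEdge β) (suc i) λ
        { zero    _   → weightAt-≢ (λ ()) (λ ())
        ; (suc q) q≢i → weightAt-≢ (λ { refl → q≢i (cong suc (sym (inverseˡ (perm β)))) }) (λ ()) })
      (weightAt-source (cong (tv (idx β)) (inverseʳ (perm β))) (λ ()))

  module Ordered (ρ : Vert → ℕ) {D : Rel ℕ 0ℓ} (D-trans : Transitive D) {β} (o : orderedB D ρ β) where

    a-before-b : ∀ p → D (ρ (av β p)) (ρ (bAt β p))
    a-before-b = proj₁ (proj₂ o)

    b-before-next : ∀ p → D (ρ (bAt β (inject₁ p))) (ρ (av β (suc p)))
    b-before-next = proj₂ (proj₂ o)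

    terminal-before-a : ∀ q p → D (ρ (termAt β q)) (ρ (av β p))
    terminal-before-a q =
      alternating-chain {R = D} D-trans (ρ ∘ av β) (ρ ∘ bAt β) (proj₁ o q) a-before-b b-before-next

    tv-before-attachment : ∀ j → D (ρ (tv (idx β) j)) (ρ (av β (suc (perm β ⟨$⟩ˡ j))))
    tv-before-attachment j = subst (λ u → D (ρ u) (ρ (av β (suc i))))
      (cong (tv (idx β)) (inverseʳ (perm β))) (terminal-before-a (suc i) (suc i))
      where i = perm β ⟨$⟩ˡ j

    a-before-bv : ∀ j → D (ρ (av β (inject₁ j))) (ρ (bv β j))
    a-before-bv j =
      subst (λ u → D (ρ (av β (inject₁ j))) (ρ u)) (bAt-inject₁ β j) (a-before-b (inject₁ j))

    bv-before-next : ∀ j → D (ρ (bv β j)) (ρ (av β (suc j)))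
    bv-before-next j =
      subst (λ u → D (ρ u) (ρ (av β (suc j)))) (bAt-inject₁ β j) (b-before-next j)

    last-a-before-root : D (ρ (av β (fromℕ _))) (ρ (rt (rootIx β)))
    last-a-before-root =
      subst (λ u → D (ρ (av β (fromℕ _))) (ρ u)) (bAt-fromℕ β) (a-before-b (fromℕ _))

    first-before-root : D (ρ (sv (idx β))) (ρ (rt (rootIx β)))
    first-before-root = D-trans (terminal-before-a zero (fromℕ _)) last-a-before-root

  -- A neighbour u of v is counted when C (ρ u) (ρ v): C = _<_ gives back loads,
  -- C = _>_ forward loads.  A bottleneck is ascending (true) or descending
  -- (false) according as it is ordered by C or by flip C.
  module Balanced (3γ+4<τ : 3 * γ + 4 < τ) (ρ : Vert → ℕ) {C : Rel ℕ 0ℓ} (C? : Decidable C)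
                  (C-trans : Transitive C) (C-asym : Asymmetric C) where
    open Arithmetic τ γ 3γ+4<τ

    earlier : Vert → Vert → Bool
    earlier v u = does (C? (ρ u) (ρ v))

    uncounted : ∀ {v u} w → C (ρ v) (ρ u) → [ earlier v u ]· w ≡ 0
    uncounted w c = cong (λ b → [ b ]· w) (dec-false (C? _ _) (C-asym c))

    Oriented : Bool → Bn → Set
    Oriented s β = orderedB (orient s C) ρ β

    module Ascending  {β} (o : Oriented true β)  = Ordered ρ {C} C-trans o
    module Descending {β} (o : Oriented false β) = Ordered ρ {flip C} (flip C-trans) o

    fromPrevious-≤ : ∀ P β p → fromPrevious P β p ≤ suc γ
    fromPrevious-≤ P β zero    = z≤n
    fromPrevious-≤ P β (suc p) = []·-≤ _ _

    fromPrevious-≡0 : ∀ {β} → Oriented false β → ∀ p → fromPrevious (earlier (av β p)) β p ≡ 0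
    fromPrevious-≡0 o zero    = refl
    fromPrevious-≡0 o (suc p) = uncounted (suc γ) (Descending.b-before-next o p)

    attW-≤ : ∀ β p → attW β p ≤ τ ∸ γ ∸ 1
    attW-≤ β zero    = 1+γ≤τ∸γ∸1
    attW-≤ β (suc j) = att-hi β j

    bnLoad-av-≤ : ∀ s β p → Oriented s β → bnLoad (earlier (av β p)) (av β p) β ≤ τ
    bnLoad-av-≤ true β p o = begin
      bnLoad P (av β p) β                    ≡⟨ bnLoad-av P β p ⟩
      [ P (bAt β p) ]· τ + (prev + attach)   ≡⟨ cong (_+ (prev + attach)) (uncounted τ (a-before-b p)) ⟩
      prev + attach                          ≤⟨ +-mono-≤ (fromPrevious-≤ P β p)
                                                         (≤-trans ([]·-≤ _ _) (attW-≤ β p)) ⟩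
      suc γ + (τ ∸ γ ∸ 1)                    ≤⟨ 1+γ+[τ∸γ∸1]≤τ ⟩
      τ                                      ∎
      where
      open ≤-Reasoning
      open Ascending o
      P = earlier (av β p)
      prev = fromPrevious P β p
      attach = [ P (termAt β p) ]· attW β p
    bnLoad-av-≤ false β p o = begin
      bnLoad P (av β p) β                    ≡⟨ bnLoad-av P β p ⟩
      [ P (bAt β p) ]· τ + (prev + attach)
        ≡⟨ cong₂ (λ x y → [ P (bAt β p) ]· τ + (x + y))
                 (fromPrevious-≡0 o p) (uncounted _ (terminal-before-a p p)) ⟩
      [ P (bAt β p) ]· τ + 0                 ≤⟨ []·+0-≤ _ τ ⟩
      τ                                      ∎
      where
      open ≤-Reasoning
      open Descending o
      P = earlier (av β p)
      prev = fromPrevious P β p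
      attach = [ P (termAt β p) ]· attW β p

    bnLoad-bv-≤ : ∀ s β j → Oriented s β → bnLoad (earlier (bv β j)) (bv β j) β ≤ τ
    bnLoad-bv-≤ true β j o = begin
      bnLoad P (bv β j) β                  ≡⟨ bnLoad-bv P β j ⟩
      [ P a ]· τ + ([ P a′ ]· suc γ + 0)
        ≡⟨ cong (λ x → [ P a ]· τ + (x + 0)) (uncounted (suc γ) (bv-before-next j)) ⟩
      [ P a ]· τ + 0                       ≤⟨ []·+0-≤ _ τ ⟩
      τ                                    ∎
      where
      open ≤-Reasoning
      open Ascending o
      P = earlier (bv β j)
      a = av β (inject₁ j)
      a′ = av β (suc j)
    bnLoad-bv-≤ false β j o = begin
      bnLoad P (bv β j) β                  ≡⟨ bnLoad-bv P β j ⟩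
      [ P a ]· τ + ([ P a′ ]· suc γ + 0)
        ≡⟨ cong (_+ ([ P a′ ]· suc γ + 0)) (uncounted τ (a-before-bv j)) ⟩
      [ P a′ ]· suc γ + 0                  ≤⟨ []·+0-≤ _ (suc γ) ⟩
      suc γ                                ≤⟨ 1+γ≤τ ⟩
      τ                                    ∎
      where
      open ≤-Reasoning
      open Descending o
      P = earlier (bv β j)
      a = av β (inject₁ j)
      a′ = av β (suc j)

    bnLoad-rt-≤ : ∀ s β → Oriented s β →
                  bnLoad (earlier (rt (rootIx β))) (rt (rootIx β)) β ≤ [ s ]· τ
    bnLoad-rt-≤ true  β o = ≤-trans (≤-reflexive (bnLoad-rt _ β)) ([]·+0-≤ _ τ)
    bnLoad-rt-≤ false β o =
      ≤-reflexive (trans (bnLoad-rt _ β) (cong (_+ 0) (uncounted τ (Descending.last-a-before-root o))))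

    bnLoad-tv-≤ : ∀ s β j → Oriented s β →
                  bnLoad (earlier (tv (idx β) j)) (tv (idx β) j) β ≤ [ not s ]· τ
    bnLoad-tv-≤ true  β j o =
      ≤-reflexive (trans (bnLoad-tv _ β j) (uncounted _ (Ascending.tv-before-attachment o j)))
    bnLoad-tv-≤ false β j o =
      ≤-trans (≤-reflexive (bnLoad-tv _ β j))
              (≤-trans ([]·-≤ _ _) (≤-trans (att-hi β _) τ∸γ∸1≤τ))

    bnLoad-sv-≤ : ∀ s β → Oriented s β →
                  bnLoad (earlier (sv (idx β))) (sv (idx β)) β ≤ [ not s ]· suc γ
    bnLoad-sv-≤ true  β o =
      ≤-reflexive (trans (bnLoad-sv _ β) (uncounted _ (Ascending.terminal-before-a o zero zero)))
    bnLoad-sv-≤ false β o = ≤-trans (≤-reflexive (bnLoad-sv _ β)) ([]·-≤ _ _)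

    midLoad-s₂-≤ : ∀ b → Oriented b p1 → Oriented b p2 → Oriented (not b) m2 → Oriented (not b) m3 →
                   midLoad (earlier s₂) s₂ ≤ [ b ]· mid + ([ not b ]· mid + 0)
    midLoad-s₂-≤ true _ o₂ _ o₄ = begin
      midLoad P s₂                          ≡⟨ midLoad-s₂ P ⟩
      [ P s₁ ]· mid + ([ P s₃ ]· mid + 0)
        ≡⟨ cong (λ x → [ P s₁ ]· mid + (x + 0)) (uncounted mid s₂≺s₃) ⟩
      [ P s₁ ]· mid + 0                     ≤⟨ +-monoˡ-≤ 0 ([]·-≤ _ mid) ⟩
      mid + 0                               ∎
      where
      open ≤-Reasoning
      P = earlier s₂
      s₂≺s₃ = C-trans (Ascending.first-before-root o₂) (Descending.first-before-root o₄)
    midLoad-s₂-≤ false o₁ _ o₃ _ = begin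
      midLoad P s₂                          ≡⟨ midLoad-s₂ P ⟩
      [ P s₁ ]· mid + ([ P s₃ ]· mid + 0)
        ≡⟨ cong (_+ ([ P s₃ ]· mid + 0)) (uncounted mid s₂≺s₁) ⟩
      [ P s₃ ]· mid + 0                     ≤⟨ +-monoˡ-≤ 0 ([]·-≤ _ mid) ⟩
      mid + 0                               ∎
      where
      open ≤-Reasoning
      P = earlier s₂
      s₂≺s₁ = C-trans (Ascending.first-before-root o₃) (Descending.first-before-root o₁)

    module _ (b : Bool) (o₁ : Oriented b p1) (o₂ : Oriented b p2)
             (o₃ : Oriented (not b) m2) (o₄ : Oriented (not b) m3) where

      oriented : ∀ β → Oriented (polarity b β) β
      oriented p1 = o₁
      oriented p2 = o₂
      oriented m2 = o₃
      oriented m3 = o₄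

      load-tv-≤ : ∀ i j → load (tv i j) (earlier (tv i j)) ≤ τ
      load-tv-≤ zero j = load-single-≤ _ (tv zero j) p1
        (λ { p1 p1≢p1 → ⊥-elim (p1≢p1 refl) ; p2 _ → ∉-tv λ ()
           ; m2 _ → ∉-tv λ () ; m3 _ → ∉-tv λ () })
        (λ _ ()) (≤-trans (bnLoad-tv-≤ b p1 j o₁) ([]·-≤ _ τ))
      load-tv-≤ (suc zero) j = ≤-trans
        (load-≤-bounds _ _ (vanishes _ (∉-tv λ ())) (bnLoad-tv-≤ b p2 j o₂)
                           (bnLoad-tv-≤ (not b) m2 j o₃) (vanishes _ (∉-tv λ ()))
                           (midLoad-vanishes _ λ _ ()))
        (≤-reflexive (trans (+-identityʳ _) ([]·+[not]·≡ (not b) τ)))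
      load-tv-≤ (suc (suc zero)) j = load-single-≤ _ (tv (suc (suc zero)) j) m3
        (λ { p1 _ → ∉-tv λ () ; p2 _ → ∉-tv λ ()
           ; m2 _ → ∉-tv λ () ; m3 m3≢m3 → ⊥-elim (m3≢m3 refl) })
        (λ _ ()) (≤-trans (bnLoad-tv-≤ (not b) m3 j o₄) ([]·-≤ _ τ))

      load-rt-≤ : ∀ r → load (rt r) (earlier (rt r)) ≤ τ
      load-rt-≤ zero = ≤-trans
        (load-≤-bounds _ _ (bnLoad-rt-≤ b p1 o₁) (vanishes _ (∉-rt λ ())) (bnLoad-rt-≤ (not b) m2 o₃)
                           (vanishes _ (∉-rt λ ())) (midLoad-vanishes _ λ _ ()))
        (≤-reflexive (trans (+-identityʳ _) ([]·+[not]·≡ b τ)))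
      load-rt-≤ (suc zero) = ≤-trans
        (load-≤-bounds _ _ (vanishes _ (∉-rt λ ())) (bnLoad-rt-≤ b p2 o₂) (vanishes _ (∉-rt λ ()))
                           (bnLoad-rt-≤ (not b) m3 o₄) (midLoad-vanishes _ λ _ ()))
        (≤-reflexive (trans (+-identityʳ _) ([]·+[not]·≡ b τ)))

      load-sv-≤ : ∀ i → load (sv i) (earlier (sv i)) ≤ τ
      load-sv-≤ zero = ≤-trans
        (load-≤-bounds _ _ (≤-trans (bnLoad-sv-≤ b p1 o₁) ([]·-≤ (not b) (suc γ)))
                           (vanishes _ (∉-sv λ ())) (vanishes _ (∉-sv λ ())) (vanishes _ (∉-sv λ ()))
                           (≤-trans (≤-reflexive (midLoad-s₁ _)) ([]·+0-≤ _ mid)))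
        (≤-trans (≤-reflexive (cong (_+ mid) (+-identityʳ (suc γ)))) 1+γ+mid≤τ)
      load-sv-≤ (suc zero) = ≤-trans
        (load-≤-bounds _ _ (vanishes _ (∉-sv λ ())) (bnLoad-sv-≤ b p2 o₂) (bnLoad-sv-≤ (not b) m2 o₃)
                           (vanishes _ (∉-sv λ ())) (midLoad-s₂-≤ b o₁ o₂ o₃ o₄))
        (≤-trans (≤-reflexive (cong₂ _+_ ([]·+[not]·≡ (not b) (suc γ)) ([]·+[not]·≡ b mid)))
                 1+γ+mid≤τ)
      load-sv-≤ (suc (suc zero)) = ≤-trans
        (load-≤-bounds _ _ (vanishes _ (∉-sv λ ())) (vanishes _ (∉-sv λ ())) (vanishes _ (∉-sv λ ()))
                           (≤-trans (bnLoad-sv-≤ (not b) m3 o₄) ([]·-≤ (not (not b)) (suc γ)))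
                           (≤-trans (≤-reflexive (midLoad-s₃ _)) ([]·+0-≤ _ mid)))
        (≤-trans (≤-reflexive (cong (_+ mid) (+-identityʳ (suc γ)))) 1+γ+mid≤τ)

      load-≤ : ∀ v → load v (earlier v) ≤ τ
      load-≤ (av β p) = load-single-≤ _ (av β p) β (λ _ → ∉-av) (λ _ ())
        (bnLoad-av-≤ (polarity b β) β p (oriented β))
      load-≤ (bv β j) = load-single-≤ _ (bv β j) β (λ _ → ∉-bv) (λ _ ())
        (bnLoad-bv-≤ (polarity b β) β j (oriented β))
      load-≤ (tv i j) = load-tv-≤ i j
      load-≤ (rt r)   = load-rt-≤ r
      load-≤ (sv i)   = load-sv-≤ i

lemma10 : (τ γ l : ℕ) → 0 < l → γ < l → 3 * γ + 4 < τ → 2 * l + γ < τ → 6 * l ≤ τ →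
    (B : BSeq τ γ) → (ρ : BSeq.Vert B → ℕ) → BSeq.DirectOrder B ρ → BSeq.Balancing B ρ
lemma10 τ γ _ _ _ 3γ+4<τ _ _ B ρ (_ , d₁ , d₂ , r₂ , r₃) v =
    subst (_≤ τ) (sym (backLoad≡load ρ v))
      (Balanced.load-≤ 3γ+4<τ ρ _<?_ <-trans <-asym true d₁ d₂ r₂ r₃ v)
  , subst (_≤ τ) (sym (fwdLoad≡load ρ v))
      (Balanced.load-≤ 3γ+4<τ ρ {_>_} (flip _<?_) (flip <-trans) <-asym false d₁ d₂ r₂ r₃ v)
  where
  open Bottlenecks B
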